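{- Let $G$ be a finite group and let $H\trianglelefteq G$ be a normal subgroup. Then $\chi(G)\leq \chi(H)\,\chi(G/H)$.
   Context: A latin square of order $n$ is an $n\times n$ array in which each row and each column is a permutation of a set of $n$ symbols. A partial transversal of a latin square is a set of cells containing at most one cell from each row, at most one cell from each column, and at most one cell containing each symbol. The chromatic number $\chi(L)$ of a latin square $L$ is the minimum number of partial transversals needed to partition the cells of $L$. For a finite group $G=\{g_0,\dots,g_{n-1}\}$, its Cayley table $L(G)$ is the latin square whose $(i,j)$ entry is $g_ig_j$; $\chi(G)$ denotes $\chi(L(G))$ (independent of the ordering of $G$). -}

module Defs where

open import Level using (Level; _⊔_; suc)
open import Data.Nat using (ℕ; _≤_)
open import Data.Fin using (Fin)
open import Data.Product using (Σ; ∃; _×_; _,_; proj₁)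
open import Data.Sum using (_⊎_)
open import Relation.Binary.PropositionalEquality using (_≡_)
open import Algebra.Bundles using (Group)

-- A "Cayley table" given by a carrier with an equivalence (cells / symbols are
-- taken up to this equivalence) and a binary operation: the cell (a , b)
-- contains the symbol a ∙ b.  Rows are indexed by a, columns by b.
record Table (a ℓ : Level) : Set (suc (a ⊔ ℓ)) where
  field
    Elt  : Set a
    _≈_  : Elt → Elt → Set ℓ
    _∙_  : Elt → Elt → Elt

-- A partition of the cells of the table into k (possibly empty) classes,
-- each class a partial transversal: two cells in the same class that share a
-- row, or a column, or a symbol, are the same cell.
record Colouring {a ℓ} (T : Table a ℓ) (k : ℕ) : Set (a ⊔ ℓ) where
  open Table T
  field
    colour   : Elt → Elt → Fin k
    respects : ∀ {x x' y y'} → x ≈ x' → y ≈ y' → colour x y ≡ colour x' y'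
    transversal : ∀ {x x' y y'} → colour x y ≡ colour x' y' →
                  (x ≈ x' ⊎ y ≈ y' ⊎ (x ∙ y) ≈ (x' ∙ y')) →
                  x ≈ x' × y ≈ y'

IsChromaticNumber : ∀ {a ℓ} → Table a ℓ → ℕ → Set (a ⊔ ℓ)
IsChromaticNumber T c = Colouring T c × (∀ k → Colouring T k → c ≤ k)

module _ {c ℓ} (G : Group c ℓ) where
  open Group G

  Finite : Set (c ⊔ ℓ)
  Finite = Σ ℕ λ n → Σ (Fin n → Carrier) λ f → ∀ x → ∃ λ i → f i ≈ x

  cayley : Table c ℓ
  cayley = record { Elt = Carrier ; _≈_ = _≈_ ; _∙_ = _∙_ }

  record NormalSubgroup (p : Level) : Set (c ⊔ ℓ ⊔ suc p) where
    field
      P        : Carrier → Set p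
      resp     : ∀ {x y} → x ≈ y → P x → P y
      ε∈       : P ε
      ∙-closed : ∀ {x y} → P x → P y → P (x ∙ y)
      ⁻¹-closed : ∀ {x} → P x → P (x ⁻¹)
      normal   : ∀ g {h} → P h → P ((g ∙ h) ∙ (g ⁻¹))

  module _ {p} (H : NormalSubgroup p) where
    open NormalSubgroup H

    cayleySub : Table (c ⊔ p) ℓ
    cayleySub = record
      { Elt = Σ Carrier P
      ; _≈_ = λ x y → proj₁ x ≈ proj₁ y
      ; _∙_ = λ { (x , px) (y , py) → (x ∙ y , ∙-closed px py) }
      }

    -- Cayley table of the quotient group G/H: elements are cosets xH,
    -- represented by elements of G, with xH = yH iff x⁻¹y ∈ H;
    -- multiplication (xH)(yH) = (xy)H.
    cayleyQuot : Table c p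
    cayleyQuot = record
      { Elt = Carrier
      ; _≈_ = λ x y → P ((x ⁻¹) ∙ y)
      ; _∙_ = _∙_
      }

module Submission where

-- Choose a representative a_x of every left coset xH and write each
-- element as x = a_x h with h ∈ H.  A cell (x , y) of the Cayley table of G
-- then determines the cell (xH , yH) of the table of G/H and, inside H, the
-- cell (b⁻¹ h b , k) where x = a h, y = b k; its symbol b⁻¹a⁻¹xy is again a
-- function of the symbol xy once the cosets are fixed.  Colouring a cell by
-- the pair (colour of its H-cell, colour of its G/H-cell) uses χ(H)·χ(G/H)
-- colours, and each colour class is a partial transversal.

open import Defs
open import Level using (Level; _⊔_)
open import Data.Nat using (ℕ; _≤_; _*_)
open import Data.Fin using (Fin; combine)
open import Data.Fin.Properties using (any?; combine-injective) renaming (_≟_ to _≟ᶠ_)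
open import Data.Product using (∃; _×_; _,_; proj₁; proj₂)
open import Data.Sum using (_⊎_; inj₁; inj₂)
open import Data.Empty using (⊥-elim)
open import Relation.Nullary using (yes; no)
open import Relation.Binary.PropositionalEquality as ≡ using (_≡_)
open import Algebra.Bundles using (Group)
import Algebra.Properties.Group as GroupProperties
import Relation.Binary.Reasoning.Setoid as SetoidReasoning

module _ {a ℓ} (T : Table a ℓ) where
  open Table T

  Cell : Set a
  Cell = Elt × Elt

  SameCell : Cell → Cell → Set ℓ
  SameCell (x , y) (x' , y') = x ≈ x' × y ≈ y'

  Conflict : Cell → Cell → Set ℓ
  Conflict (x , y) (x' , y') = x ≈ x' ⊎ y ≈ y' ⊎ (x ∙ y) ≈ (x' ∙ y')

module _ {a ℓ} {T : Table a ℓ} {k : ℕ} (C : Colouring T k) where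
  open Colouring C

  colourOf : Cell T → Fin k
  colourOf (x , y) = colour x y

  colourOf-cong : ∀ {c c'} → SameCell T c c' → colourOf c ≡ colourOf c'
  colourOf-cong {x , y} {x' , y'} (x≈x' , y≈y') = respects x≈x' y≈y'

  colourOf-transversal : ∀ {c c'} → colourOf c ≡ colourOf c' →
                         Conflict T c c' → SameCell T c c'
  colourOf-transversal {x , y} {x' , y'} = transversal

record Splitting {a ℓ a₁ ℓ₁ a₂ ℓ₂} (T : Table a ℓ) (A : Table a₁ ℓ₁) (B : Table a₂ ℓ₂)
                 : Set (a ⊔ ℓ ⊔ a₁ ⊔ ℓ₁ ⊔ a₂ ⊔ ℓ₂) where
  field
    base           : Cell T → Cell A
    fibre          : Cell T → Cell B
    base-cong      : ∀ {c c'} → SameCell T c c' → SameCell A (base c) (base c')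
    fibre-cong     : ∀ {c c'} → SameCell T c c' → SameCell B (fibre c) (fibre c')
    base-conflict  : ∀ {c c'} → Conflict T c c' → Conflict A (base c) (base c')
    fibre-conflict : ∀ {c c'} → SameCell A (base c) (base c') →
                     Conflict T c c' → Conflict B (fibre c) (fibre c')
    separating     : ∀ {c c'} → SameCell A (base c) (base c') →
                     SameCell B (fibre c) (fibre c') → SameCell T c c'

splitColouring : ∀ {a ℓ a₁ ℓ₁ a₂ ℓ₂} {T : Table a ℓ} {A : Table a₁ ℓ₁} {B : Table a₂ ℓ₂}
                 {q r : ℕ} → Splitting T A B → Colouring A q → Colouring B r →
                 Colouring T (r * q)
splitColouring {T = T} S CA CB = record
  { colour      = λ x y → pairColour (x , y)
  ; respects    = λ x≈x' y≈y' → pairColour-cong (x≈x' , y≈y')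
  ; transversal = pairColour-transversal
  }
  where
  open Splitting S

  pairColour : Cell T → Fin _
  pairColour c = combine (colourOf CB (fibre c)) (colourOf CA (base c))

  pairColour-cong : ∀ {c c'} → SameCell T c c' → pairColour c ≡ pairColour c'
  pairColour-cong same =
    ≡.cong₂ combine (colourOf-cong CB (fibre-cong same)) (colourOf-cong CA (base-cong same))

  pairColour-transversal : ∀ {c c'} → pairColour c ≡ pairColour c' →
                           Conflict T c c' → SameCell T c c'
  pairColour-transversal eq conflict = separating sameBase sameFibre
    where
    equalColours = combine-injective _ _ _ _ eq
    sameBase  = colourOf-transversal CA (proj₂ equalColours) (base-conflict conflict)
    sameFibre = colourOf-transversal CB (proj₁ equalColours) (fibre-conflict sameBase conflict)

-- If A is enumerated by Fin n (up to ≈) and labelled by Fin q, we can pick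
-- for every x a representative with the same label that depends on the
-- label alone.  (This is the constructive substitute for choosing coset
-- representatives.)
module LabelSection {a ℓ} {A : Set a} (_≈_ : A → A → Set ℓ)
                    {n : ℕ} (enum : Fin n → A) (onto : ∀ x → ∃ λ i → enum i ≈ x)
                    {q : ℕ} (label : A → Fin q)
                    (label-cong : ∀ {x y} → x ≈ y → label x ≡ label y) where

  preimage : ∀ k → (∃ λ i → label (enum i) ≡ k) → ∃ λ i → label (enum i) ≡ k
  preimage k hit with any? (λ i → label (enum i) ≟ᶠ k)
  ... | yes found = found
  ... | no none   = ⊥-elim (none hit)

  preimage-irrelevant : ∀ {k k'} → k ≡ k' → ∀ hit hit' →
                        proj₁ (preimage k hit) ≡ proj₁ (preimage k' hit')
  preimage-irrelevant {k} ≡.refl hit hit' with any? (λ i → label (enum i) ≟ᶠ k)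
  ... | yes found = ≡.refl
  ... | no none   = ⊥-elim (none hit)

  labelHit : ∀ x → ∃ λ i → label (enum i) ≡ label x
  labelHit x = proj₁ (onto x) , label-cong (proj₂ (onto x))

  rep : A → A
  rep x = enum (proj₁ (preimage (label x) (labelHit x)))

  rep-label : ∀ x → label (rep x) ≡ label x
  rep-label x = proj₂ (preimage (label x) (labelHit x))

  rep-cong : ∀ {x x'} → label x ≡ label x' → rep x ≡ rep x'
  rep-cong {x} {x'} eq =
    ≡.cong enum (preimage-irrelevant eq (labelHit x) (labelHit x'))

module Cosets {c ℓ p : Level} (G : Group c ℓ) (H : NormalSubgroup G p) where
  open Group G
  open NormalSubgroup H
  open GroupProperties G
  open SetoidReasoning setoid

  _∼_ : Carrier → Carrier → Set p
  x ∼ y = P (x ⁻¹ ∙ y)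

  ≈⇒∼ : ∀ {x y} → x ≈ y → x ∼ y
  ≈⇒∼ {x} {y} x≈y = resp (trans (sym (inverseˡ x)) (∙-congˡ x≈y)) ε∈

  record Transversal : Set (c ⊔ ℓ ⊔ p) where
    field
      rep       : Carrier → Carrier
      rep-coset : ∀ x → rep x ∼ x
      rep-cong  : ∀ {x x'} → x ∼ x' → rep x ≈ rep x'

  -- In a colouring of G/H the colours of column ε separate the cosets, so by
  -- finiteness of G a section of this labelling is a transversal.
  transversal : ∀ {q} → Finite G → Colouring (cayleyQuot G H) q → Transversal
  transversal (_ , enum , onto) CQ = record
    { rep       = rep
    ; rep-coset = λ x → separates (rep-label x)
    ; rep-cong  = λ x∼x' → reflexive (rep-cong (Q.respects x∼x' (≈⇒∼ refl)))
    }
    where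
    module Q = Colouring CQ

    cosetLabel : Carrier → Fin _
    cosetLabel x = Q.colour x ε

    separates : ∀ {x x'} → cosetLabel x ≡ cosetLabel x' → x ∼ x'
    separates eq = proj₁ (Q.transversal eq (inj₂ (inj₁ (≈⇒∼ refl))))

    open LabelSection _≈_ enum onto cosetLabel
                      (λ x≈y → Q.respects (≈⇒∼ x≈y) (≈⇒∼ refl))

  -- Coordinates in H.  With x = a h and y = b k (h , k ∈ H) the product is
  -- xy = ab (b⁻¹ h b) k, so the cell (x , y) corresponds to the H-cell
  -- (twist a b x , shift b y) = (b⁻¹ h b , k).
  twist : Carrier → Carrier → Carrier → Carrier
  twist a b x = b ⁻¹ ∙ (a ⁻¹ ∙ x) ∙ b

  shift : Carrier → Carrier → Carrier
  shift b y = b ⁻¹ ∙ y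

  twist∈ : ∀ a b {x} → a ∼ x → P (twist a b x)
  twist∈ a b h∈H = resp (∙-congˡ (⁻¹-involutive b)) (normal (b ⁻¹) h∈H)

  twist-cong : ∀ {a a' b b' x x'} → a ≈ a' → b ≈ b' → x ≈ x' →
               twist a b x ≈ twist a' b' x'
  twist-cong a≈ b≈ x≈ = ∙-cong (∙-cong (⁻¹-cong b≈) (∙-cong (⁻¹-cong a≈) x≈)) b≈

  shift-cong : ∀ {b b' y y'} → b ≈ b' → y ≈ y' → shift b y ≈ shift b' y'
  shift-cong b≈ y≈ = ∙-cong (⁻¹-cong b≈) y≈

  twist-shift : ∀ a b x y → twist a b x ∙ shift b y ≈ b ⁻¹ ∙ (a ⁻¹ ∙ (x ∙ y))
  twist-shift a b x y = begin
    b ⁻¹ ∙ (a ⁻¹ ∙ x) ∙ b ∙ (b ⁻¹ ∙ y)   ≈⟨ assoc _ b _ ⟩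
    b ⁻¹ ∙ (a ⁻¹ ∙ x) ∙ (b ∙ (b ⁻¹ ∙ y)) ≈⟨ ∙-congˡ (\\-leftDividesˡ b y) ⟩
    b ⁻¹ ∙ (a ⁻¹ ∙ x) ∙ y                ≈⟨ assoc (b ⁻¹) _ y ⟩
    b ⁻¹ ∙ (a ⁻¹ ∙ x ∙ y)                ≈⟨ ∙-congˡ (assoc (a ⁻¹) x y) ⟩
    b ⁻¹ ∙ (a ⁻¹ ∙ (x ∙ y))              ∎

  symbol-cong : ∀ {a a' b b' x x' y y'} → a ≈ a' → b ≈ b' → x ∙ y ≈ x' ∙ y' →
                twist a b x ∙ shift b y ≈ twist a' b' x' ∙ shift b' y'
  symbol-cong {a} {a'} {b} {b'} {x} {x'} {y} {y'} a≈ b≈ xy≈ = begin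
    twist a b x ∙ shift b y        ≈⟨ twist-shift a b x y ⟩
    b ⁻¹ ∙ (a ⁻¹ ∙ (x ∙ y))        ≈⟨ ∙-cong (⁻¹-cong b≈) (∙-cong (⁻¹-cong a≈) xy≈) ⟩
    b' ⁻¹ ∙ (a' ⁻¹ ∙ (x' ∙ y'))    ≈⟨ twist-shift a' b' x' y' ⟨
    twist a' b' x' ∙ shift b' y'   ∎

  twist-injective : ∀ {a a' b b' x x'} → a ≈ a' → b ≈ b' →
                    twist a b x ≈ twist a' b' x' → x ≈ x'
  twist-injective {a = a} {b = b} {x = x} {x' = x'} a≈ b≈ t≈ =
    ∙-cancelˡ (a ⁻¹) x x' (∙-cancelˡ (b ⁻¹) _ _ (∙-cancelʳ b _ _ sameCoordinates))
    where
    sameCoordinates : twist a b x ≈ twist a b x'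
    sameCoordinates = trans t≈ (twist-cong (sym a≈) (sym b≈) refl)

  shift-injective : ∀ {b b' y y'} → b ≈ b' → shift b y ≈ shift b' y' → y ≈ y'
  shift-injective {b} b≈ s≈ = ∙-cancelˡ (b ⁻¹) _ _ (trans s≈ (shift-cong (sym b≈) refl))

  splitting : Transversal → Splitting (cayley G) (cayleyQuot G H) (cayleySub G H)
  splitting R = record
    { base           = λ c → c
    ; fibre          = fibre
    ; base-cong      = λ (x≈ , y≈) → ≈⇒∼ x≈ , ≈⇒∼ y≈
    ; fibre-cong     = λ (x≈ , y≈) → twist-cong (rep-cong (≈⇒∼ x≈)) (rep-cong (≈⇒∼ y≈)) x≈
                                     , shift-cong (rep-cong (≈⇒∼ y≈)) y≈
    ; base-conflict  = base-conflict
    ; fibre-conflict = fibre-conflict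
    ; separating     = λ (x∼ , y∼) (t≈ , s≈) → twist-injective (rep-cong x∼) (rep-cong y∼) t≈
                                                , shift-injective (rep-cong y∼) s≈
    }
    where
    open Transversal R

    fibre : Cell (cayley G) → Cell (cayleySub G H)
    fibre (x , y) = (twist (rep x) (rep y) x , twist∈ (rep x) (rep y) (rep-coset x))
                  , (shift (rep y) y , rep-coset y)

    base-conflict : ∀ {c c'} → Conflict (cayley G) c c' → Conflict (cayleyQuot G H) c c'
    base-conflict (inj₁ x≈)          = inj₁ (≈⇒∼ x≈)
    base-conflict (inj₂ (inj₁ y≈))   = inj₂ (inj₁ (≈⇒∼ y≈))
    base-conflict (inj₂ (inj₂ xy≈))  = inj₂ (inj₂ (≈⇒∼ xy≈))

    fibre-conflict : ∀ {c c'} → SameCell (cayleyQuot G H) c c' →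
                     Conflict (cayley G) c c' → Conflict (cayleySub G H) (fibre c) (fibre c')
    fibre-conflict (x∼ , y∼) (inj₁ x≈)         = inj₁ (twist-cong (rep-cong x∼) (rep-cong y∼) x≈)
    fibre-conflict (x∼ , y∼) (inj₂ (inj₁ y≈))  = inj₂ (inj₁ (shift-cong (rep-cong y∼) y≈))
    fibre-conflict (x∼ , y∼) (inj₂ (inj₂ xy≈)) = inj₂ (inj₂ (symbol-cong (rep-cong x∼) (rep-cong y∼) xy≈))

lemma3p1 : ∀ {c ℓ p : Level} (G : Group c ℓ) → Finite G →
           (H : NormalSubgroup G p) →
           (χG χH χGH : ℕ) →
           IsChromaticNumber (cayley G) χG →
           IsChromaticNumber (cayleySub G H) χH →
           IsChromaticNumber (cayleyQuot G H) χGH →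
           χG ≤ χH * χGH
lemma3p1 G finite H χG χH χGH (_ , χG-minimal) (colourH , _) (colourG/H , _) =
  χG-minimal (χH * χGH) (splitColouring (splitting (transversal finite colourG/H)) colourG/H colourH)
  where open Cosets G H
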